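{- Let $E\in\mathcal P^e$ be a well-formed labeled $\pi$-calculus term. Then: (1) (Unicity) no label $\langle s,n\rangle$ occurs more than once in $E$ (as the subscript of a prefix or of a replication); (2) (Disappearance) if $E\xrightarrow{\mu}E'$ then there is $\langle s,n\rangle\in lab(E)$ with $\langle s,n\rangle\notin lab(E')$; (3) (Persistence) for every $k\ge 1$ and every sequence of transitions $E=E_0\xrightarrow{\mu_0}E_1\xrightarrow{\mu_1}E_2\cdots\xrightarrow{\mu_{k-1}}E_k$, if $\langle s,n\rangle\in lab(E_0)\cap lab(E_k)$ then $\langle s,n\rangle\in lab(E_i)$ for every $i\in\{1,\dots,k-1\}$.
   Context: Unlabeled processes. Let $\mathcal N$ be an infinite set of names. The set $\mathcal P$ of processes is generated by $P::=0\mid x(y).P\mid \bar xy.P\mid P\,|\,P\mid(\nu x)P\mid\, !P$ ($x,y\in\mathcal N$); $x(y).P$ and $(\nu x)P$ bind $y$, resp. $x$; free names $fn$, bound names $bn$ and $n(\cdot)=fn(\cdot)\cup bn(\cdot)$ are as usual, and terms are considered up to alpha-conversion. Actions $\mu$ are $xy$ (input), $\bar xy$ (output), $\bar x(y)$ (bound output) and $\tau$, with $bn(\bar x(y))=\{y\}$, $bn(\mu)=\emptyset$ otherwise, $fn(xy)=fn(\bar xy)=\{x,y\}$, $fn(\bar x(y))=\{x\}$, $fn(\tau)=\emptyset$. The (early) transition relation $\xrightarrow{\mu}$ is the least relation closed under: Input $x(y).P\xrightarrow{xz}P\{z/y\}$; Output $\bar xy.P\xrightarrow{\bar xy}P$;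 Open: $P\xrightarrow{\bar xy}P'$, $x\neq y$ imply $(\nu y)P\xrightarrow{\bar x(y)}P'$; Res: $P\xrightarrow{\mu}P'$, $y\notin n(\mu)$ imply $(\nu y)P\xrightarrow{\mu}(\nu y)P'$; Par: $P\xrightarrow{\mu}P'$, $bn(\mu)\cap fn(Q)=\emptyset$ imply $P|Q\xrightarrow{\mu}P'|Q$; Com: $P\xrightarrow{xy}P'$, $Q\xrightarrow{\bar xy}Q'$ imply $P|Q\xrightarrow{\tau}P'|Q'$; Close: $P\xrightarrow{xy}P'$, $Q\xrightarrow{\bar x(y)}Q'$, $y\notin fn(P)$ imply $P|Q\xrightarrow{\tau}(\nu y)(P'|Q')$; the symmetric versions of Par, Com, Close; Rep: $P\xrightarrow{\mu}P'$ implies $!P\xrightarrow{\mu}P'|!P$. Labeled terms. Labels are pairs $\langle s,n\rangle\in\{0,1\}^*\times\mathbb N$. For strings, $s_0\sqsubseteq s_1$ means $s_0$ is a prefix of $s_1$. For sets of labels, $L_0\,\Re\,L_1$ iff for all $\langle s_0,n_0\rangle\in L_0$ and $\langle s_1,n_1\rangle\in L_1$ we have $s_0\not\sqsubseteq s_1$ and $s_1\not\sqsubseteq s_0$. Ground labeled terms $\mathcal P^e_{gr}$: $E::=0\mid \mu_{\langle s,n\rangle}.E\mid(\nu x)E\mid E\,|\,E\mid\, !_{\langle s,n\rangle}P$, where $\mu$ is a prefix $x(y)$ or $\bar xy$ and $P\in\mathcal P$ is unlabeled. The labeling function $L_{\langle s,n\rangle}:\mathcal P\to\mathcal P^e_{gr}$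 is: $L_{\langle s,n\rangle}(0)=0$; $L_{\langle s,n\rangle}(\mu.P)=\mu_{\langle s,n\rangle}.L_{\langle s,n+1\rangle}(P)$; $L_{\langle s,n\rangle}(P_0|P_1)=L_{\langle s0,n\rangle}(P_0)\,|\,L_{\langle s1,n\rangle}(P_1)$; $L_{\langle s,n\rangle}((\nu x)P)=(\nu x)L_{\langle s,n\rangle}(P)$; $L_{\langle s,n\rangle}(!P)=\,!_{\langle s,n\rangle}P$. Top-level labels and all labels: $top(0)=lab(0)=\emptyset$; $top(\mu_v.E)=\{v\}$, $lab(\mu_v.E)=\{v\}\cup lab(E)$; $top((\nu x)E)=top(E)$, $lab((\nu x)E)=lab(E)$; $top(E_0|E_1)=top(E_0)\cup top(E_1)$, $lab(E_0|E_1)=lab(E_0)\cup lab(E_1)$; $top(!_vP)=lab(!_vP)=\{v\}$. The well-formedness predicate $wf$ is the least predicate such that: $wf(0)$; $wf(L_{\langle s,n\rangle}(\mu.P))$ for every $\mu.P\in\mathcal P$ and every label; $wf(E_0|E_1)$ whenever $wf(E_0)$, $wf(E_1)$ and $top(E_0)\,\Re\,top(E_1)$; $wf((\nu x)E)$ whenever $wf(E)$; $wf(!_{\langle s,n\rangle}P)$ for every $P\in\mathcal P$ and every label. $\mathcal P^e=\{E\in\mathcal P^e_{gr}: wf(E)\}$. Transitions of labeled terms use the same rules as for unlabeled terms with labels ignored (e.g. $x(y)_v.E\xrightarrow{xz}E\{z/y\}$, substitution not affecting labels; $\bar xy_v.E\xrightarrow{\bar xy}E$; Open, Res, Par, Com,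 Close and symmetric versions unchanged), except that replication is given by: if $P\xrightarrow{\mu}P'$ in the unlabeled semantics then $!_{\langle s,n\rangle}P\xrightarrow{\mu}L_{\langle s0,n+1\rangle}(P')\,|\,!_{\langle s1,n+1\rangle}P$. -}

module Defs where

open import Data.Nat using (ℕ; zero; suc)
open import Data.Bool using (Bool; true; false)
open import Data.List using (List; []; _∷_; _++_; [_])
open import Data.Product using (_×_; _,_; ∃)
open import Relation.Binary.PropositionalEquality using (_≡_)
open import Relation.Nullary using (¬_)
open import Data.List.Membership.Propositional using (_∈_)

-- Names: de Bruijn indices in ℕ (unscoped).  An index i under d binders
-- refers to the i-th enclosing binder if i < d, and otherwise to the free
-- name i ∸ d.  The set of names is thus infinite, and terms are
-- identified up to alpha-conversion by construction.

data Proc : Set where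
  nil : Proc
  inp : ℕ → Proc → Proc          -- x(y).P   (y = index 0 in P)
  out : ℕ → ℕ → Proc → Proc
  par : Proc → Proc → Proc
  res : Proc → Proc              -- (νx)P    (x = index 0 in P)
  rep : Proc → Proc

ext : (ℕ → ℕ) → ℕ → ℕ
ext ρ zero    = zero
ext ρ (suc i) = suc (ρ i)

ren : (ℕ → ℕ) → Proc → Proc
ren ρ nil         = nil
ren ρ (inp x P)   = inp (ρ x) (ren (ext ρ) P)
ren ρ (out x y P) = out (ρ x) (ρ y) (ren ρ P)
ren ρ (par P Q)   = par (ren ρ P) (ren ρ Q)
ren ρ (res P)     = res (ren (ext ρ) P)
ren ρ (rep P)     = rep (ren ρ P)

sub0 : ℕ → ℕ → ℕ
sub0 z zero    = z
sub0 z (suc i) = i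

swap01 : ℕ → ℕ
swap01 zero          = suc zero
swap01 (suc zero)    = zero
swap01 (suc (suc i)) = suc (suc i)

-- Actions.  For a bound output x̄(y) the bound name y is index 0 of the
-- target term, whose other free names are shifted by one.
data Act : Set where
  inA  : ℕ → ℕ → Act
  outA : ℕ → ℕ → Act
  boutA : ℕ → Act
  tau  : Act

-- weaken a parallel component / residual when the action binds a name
bump : Act → Proc → Proc
bump (boutA _) P = ren suc P
bump (inA _ _) P = P
bump (outA _ _) P = P
bump tau P = P

infix 4 _—[_]→_
data _—[_]→_ : Proc → Act → Proc → Set where
  Input  : ∀ {x P} z → inp x P —[ inA x z ]→ ren (sub0 z) P
  Output : ∀ {x y P} → out x y P —[ outA x y ]→ P
  Open   : ∀ {P P' x} → P —[ outA (suc x) zero ]→ P' → res P —[ boutA x ]→ P'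
  ResIn  : ∀ {P P' x z} → P —[ inA (suc x) (suc z) ]→ P' → res P —[ inA x z ]→ res P'
  ResOut : ∀ {P P' x y} → P —[ outA (suc x) (suc y) ]→ P' → res P —[ outA x y ]→ res P'
  ResBout : ∀ {P P' x} → P —[ boutA (suc x) ]→ P' → res P —[ boutA x ]→ res (ren swap01 P')
  ResTau : ∀ {P P'} → P —[ tau ]→ P' → res P —[ tau ]→ res P'
  ParL   : ∀ {P P' Q a} → P —[ a ]→ P' → par P Q —[ a ]→ par P' (bump a Q)
  ParR   : ∀ {P Q Q' a} → Q —[ a ]→ Q' → par P Q —[ a ]→ par (bump a P) Q'
  ComL   : ∀ {P P' Q Q' x y} → P —[ inA x y ]→ P' → Q —[ outA x y ]→ Q' → par P Q —[ tau ]→ par P' Q'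
  ComR   : ∀ {P P' Q Q' x y} → P —[ outA x y ]→ P' → Q —[ inA x y ]→ Q' → par P Q —[ tau ]→ par P' Q'
  CloseL : ∀ {P P' Q Q' x} → ren suc P —[ inA (suc x) zero ]→ P' → Q —[ boutA x ]→ Q' → par P Q —[ tau ]→ res (par P' Q')
  CloseR : ∀ {P P' Q Q' x} → P —[ boutA x ]→ P' → ren suc Q —[ inA (suc x) zero ]→ Q' → par P Q —[ tau ]→ res (par P' Q')
  Rep    : ∀ {P P' a} → P —[ a ]→ P' → rep P —[ a ]→ par P' (bump a (rep P))

Label : Set
Label = List Bool × ℕ

_⊑_ : List Bool → List Bool → Set
s ⊑ t = ∃ λ u → s ++ u ≡ t

_ℜ_ : List Label → List Label → Set
L₀ ℜ L₁ = ∀ {s₀ n₀ s₁ n₁} → (s₀ , n₀) ∈ L₀ → (s₁ , n₁) ∈ L₁ → ¬ (s₀ ⊑ s₁) × ¬ (s₁ ⊑ s₀)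

data ETerm : Set where
  enil : ETerm
  einp : Label → ℕ → ETerm → ETerm
  eout : Label → ℕ → ℕ → ETerm → ETerm
  epar : ETerm → ETerm → ETerm
  eres : ETerm → ETerm
  erep : Label → Proc → ETerm

eren : (ℕ → ℕ) → ETerm → ETerm
eren ρ enil          = enil
eren ρ (einp v x E)  = einp v (ρ x) (eren (ext ρ) E)
eren ρ (eout v x y E) = eout v (ρ x) (ρ y) (eren ρ E)
eren ρ (epar E F)    = epar (eren ρ E) (eren ρ F)
eren ρ (eres E)      = eres (eren (ext ρ) E)
eren ρ (erep v P)    = erep v (ren ρ P)

ebump : Act → ETerm → ETerm
ebump (boutA _) E = eren suc E
ebump (inA _ _) E = E
ebump (outA _ _) E = E
ebump tau E = E

-- labeling function L_⟨s,n⟩ ;  s0 = s ++ [ false ], s1 = s ++ [ true ]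
Lab : List Bool → ℕ → Proc → ETerm
Lab s n nil         = enil
Lab s n (inp x P)   = einp (s , n) x (Lab s (suc n) P)
Lab s n (out x y P) = eout (s , n) x y (Lab s (suc n) P)
Lab s n (par P Q)   = epar (Lab (s ++ [ false ]) n P) (Lab (s ++ [ true ]) n Q)
Lab s n (res P)     = eres (Lab s n P)
Lab s n (rep P)     = erep (s , n) P

-- top-level labels and all label occurrences (as lists; a label occurs
-- more than once in E iff it has duplicate entries in labs E)
top : ETerm → List Label
top enil           = []
top (einp v _ _)   = v ∷ []
top (eout v _ _ _) = v ∷ []
top (epar E F)     = top E ++ top F
top (eres E)       = top E
top (erep v _)     = v ∷ []

labs : ETerm → List Label
labs enil           = []
labs (einp v _ E)   = v ∷ labs E
labs (eout v _ _ E) = v ∷ labs E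
labs (epar E F)     = labs E ++ labs F
labs (eres E)       = labs E
labs (erep v _)     = v ∷ []

data WF : ETerm → Set where
  wf-nil : WF enil
  wf-inp : ∀ s n x P → WF (Lab s n (inp x P))
  wf-out : ∀ s n x y P → WF (Lab s n (out x y P))
  wf-par : ∀ {E F} → WF E → WF F → top E ℜ top F → WF (epar E F)
  wf-res : ∀ {E} → WF E → WF (eres E)
  wf-rep : ∀ s n P → WF (erep (s , n) P)

infix 4 _=[_]⇒_
data _=[_]⇒_ : ETerm → Act → ETerm → Set where
  Input  : ∀ {v x E} z → einp v x E =[ inA x z ]⇒ eren (sub0 z) E
  Output : ∀ {v x y E} → eout v x y E =[ outA x y ]⇒ E
  Open   : ∀ {E E' x} → E =[ outA (suc x) zero ]⇒ E' → eres E =[ boutA x ]⇒ E'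
  ResIn  : ∀ {E E' x z} → E =[ inA (suc x) (suc z) ]⇒ E' → eres E =[ inA x z ]⇒ eres E'
  ResOut : ∀ {E E' x y} → E =[ outA (suc x) (suc y) ]⇒ E' → eres E =[ outA x y ]⇒ eres E'
  ResBout : ∀ {E E' x} → E =[ boutA (suc x) ]⇒ E' → eres E =[ boutA x ]⇒ eres (eren swap01 E')
  ResTau : ∀ {E E'} → E =[ tau ]⇒ E' → eres E =[ tau ]⇒ eres E'
  ParL   : ∀ {E E' F a} → E =[ a ]⇒ E' → epar E F =[ a ]⇒ epar E' (ebump a F)
  ParR   : ∀ {E F F' a} → F =[ a ]⇒ F' → epar E F =[ a ]⇒ epar (ebump a E) F'
  ComL   : ∀ {E E' F F' x y} → E =[ inA x y ]⇒ E' → F =[ outA x y ]⇒ F' → epar E F =[ tau ]⇒ epar E' F'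
  ComR   : ∀ {E E' F F' x y} → E =[ outA x y ]⇒ E' → F =[ inA x y ]⇒ F' → epar E F =[ tau ]⇒ epar E' F'
  CloseL : ∀ {E E' F F' x} → eren suc E =[ inA (suc x) zero ]⇒ E' → F =[ boutA x ]⇒ F' → epar E F =[ tau ]⇒ eres (epar E' F')
  CloseR : ∀ {E E' F F' x} → E =[ boutA x ]⇒ E' → eren suc F =[ inA (suc x) zero ]⇒ F' → epar E F =[ tau ]⇒ eres (epar E' F')
  Rep    : ∀ {s n P P' a} → P —[ a ]→ P' →
           erep (s , n) P =[ a ]⇒ epar (Lab (s ++ [ false ]) (suc n) P') (ebump a (erep (s ++ [ true ] , suc n) P))

-- Labels form a tree: the string of a label records the position of its
-- parallel component, its number the depth of prefixes above it.  In every
-- reachable term the labels are coherent with this tree: labels under a prefix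
-- lie strictly below it, and labels of parallel components have incomparable
-- strings.  This gives unicity.  A transition replaces each label by labels at
-- or below it and strictly below the prefix (or replication) that fired, which
-- therefore disappears.  For persistence, a label v of E₀ still present in Eₖ
-- has an ancestor w ≼ v in E₁; by coherence the only way some w ≼ v can occur
-- in E₁ is that v itself survived the first step, and we recurse along the run.
module Submission where

open import Defs
open import Data.Nat using (ℕ; zero; suc; _≤_; _<_)
open import Data.Nat.Properties using (≤-refl; ≤-trans; <⇒≤; <⇒≱; <-irrefl)
open import Data.Fin using (Fin; zero; suc; toℕ; inject₁; fromℕ)
open import Data.Product using (_×_; _,_; ∃; proj₁; proj₂; swap; map₁; map₂)
open import Data.Sum using (_⊎_; inj₁; inj₂; [_,_]′) renaming (map to ⊎-map)
open import Data.Unit using (⊤; tt)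
open import Data.Empty using (⊥-elim)
open import Data.Bool using (Bool; true; false)
open import Data.List using (List; []; _∷_; _++_; [_])
open import Data.List.Properties using (++-identityʳ; ++-assoc; ∷-injective)
open import Data.List.Membership.Propositional using (_∈_; _∉_)
open import Data.List.Membership.Propositional.Properties using (∈-++⁻; ∈-++⁺ˡ; ∈-++⁺ʳ)
open import Data.List.Relation.Unary.Any using (here; there)
import Data.List.Relation.Unary.All as All
open import Data.List.Relation.Unary.AllPairs using ([]; _∷_)
open import Data.List.Relation.Unary.Unique.Propositional using (Unique)
import Data.List.Relation.Unary.Unique.Propositional.Properties as Unique
open import Data.List.Relation.Binary.Subset.Propositional using (_⊆_)
open import Data.List.Relation.Binary.Subset.Propositional.Properties using (⊆-reflexive)
open import Data.List.Relation.Binary.Disjoint.Propositional using (Disjoint)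
open import Function using (_∘_; id)
open import Relation.Binary.PropositionalEquality using (_≡_; _≢_; refl; sym; cong; cong₂; subst; subst₂)
open import Relation.Nullary using (¬_)

private
  variable
    r r' s s' t : List Bool
    b : Bool
    u v w : Label
    L L' M M' N : List Label

⊑-refl : ∀ s → s ⊑ s
⊑-refl s = [] , ++-identityʳ s

⊑-trans : r ⊑ s → s ⊑ t → r ⊑ t
⊑-trans {r} (p , refl) (q , refl) = p ++ q , sym (++-assoc r p q)

⊑-++ : ∀ s p → s ⊑ (s ++ p)
⊑-++ s p = p , refl

⊑-∷ : r ⊑ s → (b ∷ r) ⊑ (b ∷ s)
⊑-∷ (p , eq) = p , cong (_ ∷_) eq

⊑-∷⁻ : (b ∷ r) ⊑ (b ∷ s) → r ⊑ s
⊑-∷⁻ (p , eq) = p , proj₂ (∷-injective eq)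

⊑-comparable : r ⊑ t → s ⊑ t → r ⊑ s ⊎ s ⊑ r
⊑-comparable {r = []}    {s = s}     _        _        = inj₁ (s , refl)
⊑-comparable {r = _ ∷ _} {s = []}    _        _        = inj₂ (_ , refl)
⊑-comparable {r = _ ∷ r} {s = _ ∷ s} (p , refl) (q , eq) with ∷-injective eq
... | refl , eq′ = ⊎-map ⊑-∷ ⊑-∷ (⊑-comparable {r = r} (p , refl) (q , eq′))

infix 4 _∥_

_∥_ : List Bool → List Bool → Set
s ∥ t = ¬ (s ⊑ t) × ¬ (t ⊑ s)

∥-sym : s ∥ t → t ∥ s
∥-sym = swap

∥-monoˡ : r ⊑ s → r ∥ t → s ∥ t
∥-monoˡ r⊑s (r⋢t , t⋢r) =
  (λ s⊑t → r⋢t (⊑-trans r⊑s s⊑t)) ,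
  (λ t⊑s → [ r⋢t , t⋢r ]′ (⊑-comparable r⊑s t⊑s))

∥-mono : r ⊑ s → r' ⊑ s' → r ∥ r' → s ∥ s'
∥-mono p q = ∥-sym ∘ ∥-monoˡ q ∘ ∥-sym ∘ ∥-monoˡ p

∥-branch : ∀ s → (s ++ [ false ]) ∥ (s ++ [ true ])
∥-branch []      = (λ { (_ , ()) }) , (λ { (_ , ()) })
∥-branch (_ ∷ s) = let (p , q) = ∥-branch s in p ∘ ⊑-∷⁻ , q ∘ ⊑-∷⁻

infix 4 _≼_ _≺_

_≼_ : Label → Label → Set
v ≼ w = proj₁ v ⊑ proj₁ w × proj₂ v ≤ proj₂ w

_≺_ : Label → Label → Set
v ≺ w = proj₁ v ⊑ proj₁ w × proj₂ v < proj₂ w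

≼-refl : v ≼ v
≼-refl {v} = ⊑-refl (proj₁ v) , ≤-refl

≼-trans : u ≼ v → v ≼ w → u ≼ w
≼-trans (p , m) (q , n) = ⊑-trans p q , ≤-trans m n

≺⇒≼ : v ≺ w → v ≼ w
≺⇒≼ = map₂ <⇒≤

≺-≼-trans : u ≺ v → v ≼ w → u ≺ w
≺-≼-trans (p , m) (q , n) = ⊑-trans p q , ≤-trans m n

≺⇒⋡ : v ≺ w → ¬ (w ≼ v)
≺⇒⋡ (_ , v<w) (_ , w≤v) = <⇒≱ v<w w≤v

≺⇒≢ : v ≺ w → v ≢ w
≺⇒≢ (_ , v<w) refl = <-irrefl refl v<w

branch-≺ : ∀ s n p → (s , n) ≺ (s ++ p , suc n)
branch-≺ s n p = ⊑-++ s p , ≤-refl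

infix 4 _⇝_

_⇝_ : List Label → List Label → Set
L ⇝ L' = ∀ {w} → w ∈ L' → ∃ λ v → v ∈ L × v ≼ w

⊇⇒⇝ : L' ⊆ L → L ⇝ L'
⊇⇒⇝ L'⊆L w∈L' = _ , L'⊆L w∈L' , ≼-refl

⇝-refl : L ⇝ L
⇝-refl = ⊇⇒⇝ id

≡⇒⇝ : L ≡ L' → L ⇝ L'
≡⇒⇝ refl = ⇝-refl

⇝-trans : L ⇝ M → M ⇝ N → L ⇝ N
⇝-trans L⇝M M⇝N w∈N =
  let (u , u∈M , u≼w) = M⇝N w∈N
      (v , v∈L , v≼u) = L⇝M u∈M
  in v , v∈L , ≼-trans v≼u u≼w

⇝-++ : L ⇝ L' → M ⇝ M' → L ++ M ⇝ L' ++ M'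
⇝-++ {L} {L'} L⇝L' M⇝M' w∈ with ∈-++⁻ L' w∈
... | inj₁ w∈L' = map₂ (map₁ ∈-++⁺ˡ) (L⇝L' w∈L')
... | inj₂ w∈M' = map₂ (map₁ (∈-++⁺ʳ L)) (M⇝M' w∈M')

≼-all⇒⇝ : v ∈ L → (∀ {w} → w ∈ L' → v ≼ w) → L ⇝ L'
≼-all⇒⇝ v∈L v≼ w∈L' = _ , v∈L , v≼ w∈L'

ℜ-sym : L ℜ M → M ℜ L
ℜ-sym sep p q = swap (sep q p)

ℜ-⇝ : L ℜ M → L ⇝ L' → M ⇝ M' → L' ℜ M'
ℜ-⇝ sep L⇝L' M⇝M' p q =
  let (v , v∈L , v≼) = L⇝L' p
      (u , u∈M , u≼) = M⇝M' q
  in ∥-mono (proj₁ v≼) (proj₁ u≼) (sep v∈L u∈M)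

ℜ⇒⋡ : L ℜ M → v ∈ L → w ∈ M → ¬ (w ≼ v)
ℜ⇒⋡ sep v∈L w∈M w≼v = proj₂ (sep v∈L w∈M) (proj₁ w≼v)

ℜ⇒Disjoint : L ℜ M → Disjoint L M
ℜ⇒Disjoint sep (v∈L , v∈M) = ℜ⇒⋡ sep v∈L v∈M ≼-refl

ℜ-singleton : ∀ {m n} → s ∥ t → [ (s , m) ] ℜ [ (t , n) ]
ℜ-singleton s∥t (here refl) (here refl) = s∥t

labs-eren : ∀ ρ E → labs (eren ρ E) ≡ labs E
labs-eren ρ enil           = refl
labs-eren ρ (einp v x E)   = cong (v ∷_) (labs-eren (ext ρ) E)
labs-eren ρ (eout v x y E) = cong (v ∷_) (labs-eren ρ E)
labs-eren ρ (epar E F)     = cong₂ _++_ (labs-eren ρ E) (labs-eren ρ F)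
labs-eren ρ (eres E)       = labs-eren (ext ρ) E
labs-eren ρ (erep v P)     = refl

labs-ebump : ∀ a E → labs (ebump a E) ≡ labs E
labs-ebump (inA _ _)  E = refl
labs-ebump (outA _ _) E = refl
labs-ebump (boutA _)  E = labs-eren suc E
labs-ebump tau        E = refl

eren-⇝ : ∀ ρ E → labs E ⇝ labs (eren ρ E)
eren-⇝ ρ E = ≡⇒⇝ (sym (labs-eren ρ E))

ebump-⇝ : ∀ a E → labs E ⇝ labs (ebump a E)
ebump-⇝ a E = ≡⇒⇝ (sym (labs-ebump a E))

Lab-≽ : ∀ t m P {w} → w ∈ labs (Lab t m P) → (t , m) ≼ w
Lab-≽ t m (inp x P)   (here refl) = ≼-refl
Lab-≽ t m (inp x P)   (there q)   = ≺⇒≼ (Lab-≽ t (suc m) P q)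
Lab-≽ t m (out x y P) (here refl) = ≼-refl
Lab-≽ t m (out x y P) (there q)   = ≺⇒≼ (Lab-≽ t (suc m) P q)
Lab-≽ t m (par P Q)   q with ∈-++⁻ (labs (Lab (t ++ [ false ]) m P)) q
... | inj₁ q′ = ≼-trans (⊑-++ t _ , ≤-refl) (Lab-≽ _ m P q′)
... | inj₂ q′ = ≼-trans (⊑-++ t _ , ≤-refl) (Lab-≽ _ m Q q′)
Lab-≽ t m (res P)     q           = Lab-≽ t m P q
Lab-≽ t m (rep P)     (here refl) = ≼-refl

Lab-⇝ : ∀ t m P → [ (t , m) ] ⇝ labs (Lab t m P)
Lab-⇝ t m P = ≼-all⇒⇝ (here refl) (Lab-≽ t m P)

top⇝labs : ∀ {E} → WF E → top E ⇝ labs E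
top⇝labs wf-nil             = λ ()
top⇝labs (wf-inp s n x P)   = Lab-⇝ s n (inp x P)
top⇝labs (wf-out s n x y P) = Lab-⇝ s n (out x y P)
top⇝labs (wf-par wfE wfF _) = ⇝-++ (top⇝labs wfE) (top⇝labs wfF)
top⇝labs (wf-res wfE)       = top⇝labs wfE
top⇝labs (wf-rep s n P)     = ⇝-refl

-- Unlike WF, which only constrains top-level labels, this invariant is
-- preserved by transitions.
Coherent : ETerm → Set
Coherent enil           = ⊤
Coherent (einp v _ E)   = Coherent E × (∀ {w} → w ∈ labs E → v ≺ w)
Coherent (eout v _ _ E) = Coherent E × (∀ {w} → w ∈ labs E → v ≺ w)
Coherent (epar E F)     = Coherent E × Coherent F × labs E ℜ labs F
Coherent (eres E)       = Coherent E
Coherent (erep _ _)     = ⊤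

Coherent-eren : ∀ ρ E → Coherent E → Coherent (eren ρ E)
Coherent-eren ρ enil           _              = tt
Coherent-eren ρ (einp v x E)   (cE , below)   =
  Coherent-eren (ext ρ) E cE , below ∘ ⊆-reflexive (labs-eren (ext ρ) E)
Coherent-eren ρ (eout v x y E) (cE , below)   =
  Coherent-eren ρ E cE , below ∘ ⊆-reflexive (labs-eren ρ E)
Coherent-eren ρ (epar E F)     (cE , cF , sep) =
  Coherent-eren ρ E cE , Coherent-eren ρ F cF ,
  subst₂ _ℜ_ (sym (labs-eren ρ E)) (sym (labs-eren ρ F)) sep
Coherent-eren ρ (eres E)       cE             = Coherent-eren (ext ρ) E cE
Coherent-eren ρ (erep v P)     _              = tt

Coherent-ebump : ∀ a E → Coherent E → Coherent (ebump a E)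
Coherent-ebump (inA _ _)  E = id
Coherent-ebump (outA _ _) E = id
Coherent-ebump (boutA _)  E = Coherent-eren suc E
Coherent-ebump tau        E = id

Lab-coherent : ∀ t m P → Coherent (Lab t m P)
Lab-coherent t m nil         = tt
Lab-coherent t m (inp x P)   = Lab-coherent t (suc m) P , Lab-≽ t (suc m) P
Lab-coherent t m (out x y P) = Lab-coherent t (suc m) P , Lab-≽ t (suc m) P
Lab-coherent t m (par P Q)   =
  Lab-coherent _ m P , Lab-coherent _ m Q ,
  ℜ-⇝ (ℜ-singleton (∥-branch t)) (Lab-⇝ _ m P) (Lab-⇝ _ m Q)
Lab-coherent t m (res P)     = Lab-coherent t m P
Lab-coherent t m (rep P)     = tt

WF⇒Coherent : ∀ {E} → WF E → Coherent E
WF⇒Coherent wf-nil                 = tt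
WF⇒Coherent (wf-inp s n x P)       = Lab-coherent s n (inp x P)
WF⇒Coherent (wf-out s n x y P)     = Lab-coherent s n (out x y P)
WF⇒Coherent (wf-par wfE wfF top-ℜ) =
  WF⇒Coherent wfE , WF⇒Coherent wfF , ℜ-⇝ top-ℜ (top⇝labs wfE) (top⇝labs wfF)
WF⇒Coherent (wf-res wfE)           = WF⇒Coherent wfE
WF⇒Coherent (wf-rep s n P)         = tt

Coherent⇒Unique : ∀ E → Coherent E → Unique (labs E)
Coherent⇒Unique enil           _              = []
Coherent⇒Unique (einp v x E)   (cE , below)   = All.tabulate (≺⇒≢ ∘ below) ∷ Coherent⇒Unique E cE
Coherent⇒Unique (eout v x y E) (cE , below)   = All.tabulate (≺⇒≢ ∘ below) ∷ Coherent⇒Unique E cE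
Coherent⇒Unique (epar E F)     (cE , cF , sep) =
  Unique.++⁺ (Coherent⇒Unique E cE) (Coherent⇒Unique F cF) (ℜ⇒Disjoint sep)
Coherent⇒Unique (eres E)       cE             = Coherent⇒Unique E cE
Coherent⇒Unique (erep v P)     _              = All.[] ∷ []

rep-residual-≻ : ∀ s n P P' a {w} →
  w ∈ labs (epar (Lab (s ++ [ false ]) (suc n) P') (ebump a (erep (s ++ [ true ] , suc n) P))) →
  (s , n) ≺ w
rep-residual-≻ s n P P' a q with ∈-++⁻ (labs (Lab (s ++ [ false ]) (suc n) P')) q
... | inj₁ q′ = ≺-≼-trans (branch-≺ s n _) (Lab-≽ _ _ P' q′)
... | inj₂ q′ with ⊆-reflexive (labs-ebump a (erep (s ++ [ true ] , suc n) P)) q′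
...   | here refl = branch-≺ s n _

step-⇝ : ∀ {E a E'} → E =[ a ]⇒ E' → labs E ⇝ labs E'
step-⇝ {einp v x E} (Input z)            = ⇝-trans (⊇⇒⇝ there) (eren-⇝ (sub0 z) E)
step-⇝ Output                            = ⊇⇒⇝ there
step-⇝ (Open t)                          = step-⇝ t
step-⇝ (ResIn t)                         = step-⇝ t
step-⇝ (ResOut t)                        = step-⇝ t
step-⇝ (ResBout {E' = E'} t)             = ⇝-trans (step-⇝ t) (eren-⇝ swap01 E')
step-⇝ (ResTau t)                        = step-⇝ t
step-⇝ {epar E F} (ParL {a = a} t)       = ⇝-++ (step-⇝ t) (ebump-⇝ a F)
step-⇝ {epar E F} (ParR {a = a} t)       = ⇝-++ (ebump-⇝ a E) (step-⇝ t)
step-⇝ (ComL t u)                        = ⇝-++ (step-⇝ t) (step-⇝ u)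
step-⇝ (ComR t u)                        = ⇝-++ (step-⇝ t) (step-⇝ u)
step-⇝ {epar E F} (CloseL t u)           = ⇝-++ (⇝-trans (eren-⇝ suc E) (step-⇝ t)) (step-⇝ u)
step-⇝ {epar E F} (CloseR t u)           = ⇝-++ (step-⇝ t) (⇝-trans (eren-⇝ suc F) (step-⇝ u))
step-⇝ (Rep {s = s} {n} {P} {P'} {a} t)  = ≼-all⇒⇝ (here refl) (≺⇒≼ ∘ rep-residual-≻ s n P P' a)

Coherent-step : ∀ {E a E'} → Coherent E → E =[ a ]⇒ E' → Coherent E'
Coherent-step {einp v x E} (cE , _) (Input z) = Coherent-eren (sub0 z) E cE
Coherent-step (cE , _) Output                 = cE
Coherent-step c (Open t)                      = Coherent-step c t
Coherent-step c (ResIn t)                     = Coherent-step c t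
Coherent-step c (ResOut t)                    = Coherent-step c t
Coherent-step c (ResBout {E' = E'} t)         = Coherent-eren swap01 E' (Coherent-step c t)
Coherent-step c (ResTau t)                    = Coherent-step c t
Coherent-step {epar E F} (cE , cF , sep) (ParL {a = a} t) =
  Coherent-step cE t , Coherent-ebump a F cF , ℜ-⇝ sep (step-⇝ t) (ebump-⇝ a F)
Coherent-step {epar E F} (cE , cF , sep) (ParR {a = a} t) =
  Coherent-ebump a E cE , Coherent-step cF t , ℜ-⇝ sep (ebump-⇝ a E) (step-⇝ t)
Coherent-step (cE , cF , sep) (ComL t u) =
  Coherent-step cE t , Coherent-step cF u , ℜ-⇝ sep (step-⇝ t) (step-⇝ u)
Coherent-step (cE , cF , sep) (ComR t u) =
  Coherent-step cE t , Coherent-step cF u , ℜ-⇝ sep (step-⇝ t) (step-⇝ u)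
Coherent-step {epar E F} (cE , cF , sep) (CloseL t u) =
  Coherent-step (Coherent-eren suc E cE) t , Coherent-step cF u ,
  ℜ-⇝ sep (⇝-trans (eren-⇝ suc E) (step-⇝ t)) (step-⇝ u)
Coherent-step {epar E F} (cE , cF , sep) (CloseR t u) =
  Coherent-step cE t , Coherent-step (Coherent-eren suc F cF) u ,
  ℜ-⇝ sep (step-⇝ t) (⇝-trans (eren-⇝ suc F) (step-⇝ u))
Coherent-step _ (Rep {s = s} {n} {P} {P'} {a} t) =
  Lab-coherent _ _ P' , Coherent-ebump a _ tt ,
  ℜ-⇝ (ℜ-singleton (∥-branch s)) (Lab-⇝ _ _ P') (ebump-⇝ a (erep (s ++ [ true ] , suc n) P))

Persists : List Label → List Label → Set
Persists L L' = ∀ {d w} → d ∈ L → w ∈ L' → w ≼ d → d ∈ L'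

⊆⇒Persists : L ⊆ L' → Persists L L'
⊆⇒Persists L⊆L' d∈L _ _ = L⊆L' d∈L

Persists-∷ : (∀ {w} → w ∈ L' → v ≺ w) → L ⊆ L' → Persists (v ∷ L) L'
Persists-∷ above _    (here refl) w∈L' w≼v = ⊥-elim (≺⇒⋡ (above w∈L') w≼v)
Persists-∷ _     L⊆L' (there d∈L) _    _   = L⊆L' d∈L

Persists-++ : L ℜ M → L ⇝ L' → M ⇝ M' → Persists L L' → Persists M M' →
              Persists (L ++ M) (L' ++ M')
Persists-++ {L} {M} {L'} sep L⇝L' M⇝M' pL pM d∈ w∈ w≼d with ∈-++⁻ L d∈ | ∈-++⁻ L' w∈
... | inj₁ d∈L | inj₁ w∈L' = ∈-++⁺ˡ (pL d∈L w∈L' w≼d)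
... | inj₂ d∈M | inj₂ w∈M' = ∈-++⁺ʳ L' (pM d∈M w∈M' w≼d)
... | inj₁ d∈L | inj₂ w∈M' = ⊥-elim (ℜ⇒⋡ (ℜ-⇝ sep ⇝-refl M⇝M') d∈L w∈M' w≼d)
... | inj₂ d∈M | inj₁ w∈L' = ⊥-elim (ℜ⇒⋡ (ℜ-sym (ℜ-⇝ sep L⇝L' ⇝-refl)) d∈M w∈L' w≼d)

ebump-Persists : ∀ a E → Persists (labs E) (labs (ebump a E))
ebump-Persists a E = ⊆⇒Persists (⊆-reflexive (sym (labs-ebump a E)))

persists-step : ∀ {E a E'} → Coherent E → E =[ a ]⇒ E' → Persists (labs E) (labs E')
persists-step {einp v x E} (_ , above) (Input z) =
  Persists-∷ (above ∘ ⊆-reflexive (labs-eren (sub0 z) E)) (⊆-reflexive (sym (labs-eren (sub0 z) E)))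
persists-step (_ , above) Output  = Persists-∷ above id
persists-step c (Open t)          = persists-step c t
persists-step c (ResIn t)         = persists-step c t
persists-step c (ResOut t)        = persists-step c t
persists-step c (ResBout {E' = E'} t) =
  subst (Persists _) (sym (labs-eren swap01 E')) (persists-step c t)
persists-step c (ResTau t)        = persists-step c t
persists-step {epar E F} (cE , cF , sep) (ParL {a = a} t) =
  Persists-++ sep (step-⇝ t) (ebump-⇝ a F) (persists-step cE t) (ebump-Persists a F)
persists-step {epar E F} (cE , cF , sep) (ParR {a = a} t) =
  Persists-++ sep (ebump-⇝ a E) (step-⇝ t) (ebump-Persists a E) (persists-step cF t)
persists-step (cE , cF , sep) (ComL t u) =
  Persists-++ sep (step-⇝ t) (step-⇝ u) (persists-step cE t) (persists-step cF u)
persists-step (cE , cF , sep) (ComR t u) =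
  Persists-++ sep (step-⇝ t) (step-⇝ u) (persists-step cE t) (persists-step cF u)
persists-step {epar E F} (cE , cF , sep) (CloseL t u) =
  Persists-++ sep (⇝-trans (eren-⇝ suc E) (step-⇝ t)) (step-⇝ u)
    (subst (λ L → Persists L _) (labs-eren suc E) (persists-step (Coherent-eren suc E cE) t))
    (persists-step cF u)
persists-step {epar E F} (cE , cF , sep) (CloseR t u) =
  Persists-++ sep (step-⇝ t) (⇝-trans (eren-⇝ suc F) (step-⇝ u))
    (persists-step cE t)
    (subst (λ L → Persists L _) (labs-eren suc F) (persists-step (Coherent-eren suc F cF) u))
persists-step _ (Rep {s = s} {n} {P} {P'} {a} t) = Persists-∷ (rep-residual-≻ s n P P' a) (λ ())

Disappears : List Label → List Label → Set
Disappears L L' = ∃ λ v → v ∈ L × v ∉ L'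

Disappears-∷ : (∀ {w} → w ∈ L' → v ≺ w) → Disappears (v ∷ L) L'
Disappears-∷ above = _ , here refl , λ v∈L' → ≺⇒≢ (above v∈L') refl

Disappears-++ˡ : L ℜ M' → Disappears L L' → Disappears (L ++ M) (L' ++ M')
Disappears-++ˡ {L' = L'} sep (v , v∈L , v∉L') =
  v , ∈-++⁺ˡ v∈L , [ v∉L' , (λ v∈M' → ℜ⇒Disjoint sep (v∈L , v∈M')) ]′ ∘ ∈-++⁻ L'

Disappears-++ʳ : L' ℜ M → Disappears M M' → Disappears (L ++ M) (L' ++ M')
Disappears-++ʳ {L' = L'} {L = L} sep (v , v∈M , v∉M') =
  v , ∈-++⁺ʳ L v∈M , [ (λ v∈L' → ℜ⇒Disjoint sep (v∈L' , v∈M)) , v∉M' ]′ ∘ ∈-++⁻ L'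

disappears-step : ∀ {E a E'} → Coherent E → E =[ a ]⇒ E' → Disappears (labs E) (labs E')
disappears-step {einp v x E} (_ , above) (Input z) =
  Disappears-∷ (above ∘ ⊆-reflexive (labs-eren (sub0 z) E))
disappears-step (_ , above) Output = Disappears-∷ above
disappears-step c (Open t)         = disappears-step c t
disappears-step c (ResIn t)        = disappears-step c t
disappears-step c (ResOut t)       = disappears-step c t
disappears-step c (ResBout {E' = E'} t) =
  subst (Disappears _) (sym (labs-eren swap01 E')) (disappears-step c t)
disappears-step c (ResTau t)       = disappears-step c t
disappears-step {epar E F} (cE , cF , sep) (ParL {a = a} t) =
  Disappears-++ˡ (ℜ-⇝ sep ⇝-refl (ebump-⇝ a F)) (disappears-step cE t)
disappears-step {epar E F} (cE , cF , sep) (ParR {a = a} t) =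
  Disappears-++ʳ (ℜ-⇝ sep (ebump-⇝ a E) ⇝-refl) (disappears-step cF t)
disappears-step (cE , cF , sep) (ComL t u) =
  Disappears-++ˡ (ℜ-⇝ sep ⇝-refl (step-⇝ u)) (disappears-step cE t)
disappears-step (cE , cF , sep) (ComR t u) =
  Disappears-++ˡ (ℜ-⇝ sep ⇝-refl (step-⇝ u)) (disappears-step cE t)
disappears-step {epar E F} (cE , cF , sep) (CloseL t u) =
  Disappears-++ˡ (ℜ-⇝ sep ⇝-refl (step-⇝ u))
    (subst (λ L → Disappears L _) (labs-eren suc E) (disappears-step (Coherent-eren suc E cE) t))
disappears-step {epar E F} (cE , cF , sep) (CloseR t u) =
  Disappears-++ˡ (ℜ-⇝ sep ⇝-refl (⇝-trans (eren-⇝ suc F) (step-⇝ u))) (disappears-step cE t)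
disappears-step _ (Rep {s = s} {n} {P} {P'} {a} t) = Disappears-∷ (rep-residual-≻ s n P P' a)

Run : ∀ k → (Fin (suc k) → ETerm) → (Fin k → Act) → Set
Run k Es μs = ∀ (i : Fin k) → Es (inject₁ i) =[ μs i ]⇒ Es (suc i)

run-⇝ : ∀ k Es μs → Run k Es μs → labs (Es zero) ⇝ labs (Es (fromℕ k))
run-⇝ zero    Es μs run = ⇝-refl
run-⇝ (suc k) Es μs run = ⇝-trans (step-⇝ (run zero)) (run-⇝ k (Es ∘ suc) (μs ∘ suc) (run ∘ suc))

run-persists : ∀ k Es μs → Run k Es μs → Coherent (Es zero) →
  ∀ {v} → v ∈ labs (Es zero) → v ∈ labs (Es (fromℕ k)) → ∀ i → v ∈ labs (Es i)
run-persists k       Es μs run c v∈₀ v∈ₖ zero    = v∈₀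
run-persists (suc k) Es μs run c {v} v∈₀ v∈ₖ (suc i) =
  run-persists k (Es ∘ suc) (μs ∘ suc) (run ∘ suc) (Coherent-step c (run zero)) v∈₁ v∈ₖ i
  where
  v∈₁ : v ∈ labs (Es (suc zero))
  v∈₁ = let (w , w∈₁ , w≼v) = run-⇝ k (Es ∘ suc) (μs ∘ suc) (run ∘ suc) v∈ₖ
        in persists-step c (run zero) v∈₀ w∈₁ w≼v

theorem4p8 : ∀ (E : ETerm) → WF E →
    Unique (labs E)
    × (∀ {μ E'} → E =[ μ ]⇒ E' → ∃ λ v → v ∈ labs E × v ∉ labs E')
    × (∀ (k : ℕ) → 1 ≤ k → (Es : Fin (suc k) → ETerm) → (μs : Fin k → Act) →
         Es zero ≡ E → (∀ (i : Fin k) → Es (inject₁ i) =[ μs i ]⇒ Es (suc i)) →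
         ∀ (v : Label) → v ∈ labs (Es zero) → v ∈ labs (Es (fromℕ k)) →
         ∀ (i : Fin (suc k)) → 1 ≤ toℕ i → toℕ i < k → v ∈ labs (Es i))
theorem4p8 E wf =
  Coherent⇒Unique E c ,
  disappears-step c ,
  λ k _ Es μs Es₀≡E run v v∈₀ v∈ₖ i _ _ →
    run-persists k Es μs run (subst Coherent (sym Es₀≡E) c) v∈₀ v∈ₖ i
  where
  c : Coherent E
  c = WF⇒Coherent wf
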